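{- Let $G=(L,R,E)$ be a finite bipartite graph whose vertex sets $L$ and $R$ are each equipped with a linear ordering $\succ$, and suppose $G$ has an $L$-saturating matching with the PBT-property. Then the matching $M^{PBT}_G$ returned by the procedure $P^{PBT}_{greedy}$ is $L$-saturating, and among all $L$-saturating matchings of $G$ with the PBT-property, $M^{PBT}_G$ has the smallest order.
   Context: Write $x\sim y$ if $\{x,y\}\in E$. Let $y_1\succ\dots\succ y_N$ list $R$ in order of preference. A matching $M$ is $L$-saturating if every vertex of $L$ is matched by $M$; its order is the smallest $k$ such that $M$ is $L$-saturating and leaves $y_{k+1},\dots,y_N$ unmatched (order $\infty$ if $M$ is not $L$-saturating). An $L$-saturating matching $M$ has the PBT-property if for all $x,x'\in L$, $y\in R$ with $y$ the $M$-partner of $x$ and $x'\succ x$, we have $x'\not\sim y$. For a matching $M$, let $L_M$ be the set of vertices of $L$ unmatched by $M$ that are adjacent to some vertex of $R$ unmatched by $M$, and $R_M$ the analogous subset of $R$. Procedure $P^{PBT}_{greedy}$: start with $M=\emptyset$ and repeat: (1) if $L_M=\emptyset$, return $M$; otherwise let $x^*$ be the most preferred vertex of $L_M$ and let $R'_M=\{y\in R_M : y\sim x^* \text{ and } y\not\sim x' \text{ for every } x'\in L \text{ with } x'\succ x^*\}$; (2) if $R'_M=\emptyset$, return $M$; otherwise let $y^*$ be the most preferred vertex of $R'_M$ and add $\{x^*,y^*\}$ to $M$. The returned matching is $M^{PBT}_G$. -}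

module Defs where

open import Data.Nat using (ℕ; zero; suc; _⊔_)
open import Data.Fin using (Fin; zero; suc; toℕ; _≟_; _<?_) renaming (_<_ to _<ᶠ_)
open import Data.Bool using (Bool; true; false; if_then_else_; not; _∧_; T)
open import Data.Maybe using (Maybe; just; nothing; is-just; is-nothing; maybe)
import Data.Maybe as Maybe
open import Data.Product using (Σ; _×_; ∃)
open import Relation.Nullary using (¬_; does)
open import Relation.Binary.PropositionalEquality using (_≡_)
open import Function using (_∘_)

-- L = Fin m, R = Fin n.  The linear orders ≻ on L and on R are the index
-- orders: x' ≻ x  iff  toℕ x' < toℕ x  (index 0 is the most preferred).
-- So y₁ ≻ … ≻ y_N corresponds to Fin indices 0, …, n-1.
-- The edge set is a Boolean adjacency E : Fin m → Fin n → Bool; x ∼ y iff T (E x y).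

Graph : ℕ → ℕ → Set
Graph m n = Fin m → Fin n → Bool

-- A matching is represented by its partner function on L
-- (M x = just y iff {x,y} ∈ M).
PMatching : ℕ → ℕ → Set
PMatching m n = Fin m → Maybe (Fin n)

IsMatching : ∀ {m n} → Graph m n → PMatching m n → Set
IsMatching {m} {n} E M =
  ((x : Fin m) (y : Fin n) → M x ≡ just y → T (E x y)) ×
  ((x x' : Fin m) (y : Fin n) → M x ≡ just y → M x' ≡ just y → x ≡ x')

Saturating : ∀ {m n} → PMatching m n → Set
Saturating {m} {n} M = (x : Fin m) → Σ (Fin n) (λ y → M x ≡ just y)

PBT : ∀ {m n} → Graph m n → PMatching m n → Set
PBT {m} {n} E M = (x x' : Fin m) (y : Fin n) → M x ≡ just y → x' <ᶠ x → ¬ T (E x' y)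

maxF : ∀ {k} → (Fin k → ℕ) → ℕ
maxF {zero} f = 0
maxF {suc k} f = f zero ⊔ maxF (f ∘ suc)

-- Order of a matching: the smallest k such that y_{k+1},…,y_N are unmatched,
-- i.e. the maximum over matched y of (rank of y) = toℕ y + 1.
-- (Only meaningful for L-saturating matchings; for those it is exactly the
-- paper's order.)
order : ∀ {m n} → PMatching m n → ℕ
order M = maxF (λ x → maybe (λ y → suc (toℕ y)) 0 (M x))

first : ∀ {k} → (Fin k → Bool) → Maybe (Fin k)
first {zero} p = nothing
first {suc k} p = if p zero then just zero else Maybe.map suc (first (p ∘ suc))

anyF : ∀ {k} → (Fin k → Bool) → Bool
anyF p = is-just (first p)

allF : ∀ {k} → (Fin k → Bool) → Bool
allF p = not (anyF (not ∘ p))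

module Greedy {m n : ℕ} (E : Graph m n) where

  matchedR : PMatching m n → Fin n → Bool
  matchedR M y = anyF (λ x → maybe (λ y' → does (y' ≟ y)) false (M x))

  inLM : PMatching m n → Fin m → Bool
  inLM M x = is-nothing (M x) ∧ anyF (λ y → not (matchedR M y) ∧ E x y)

  -- membership in R'_M (given x*); y ∈ R_M is implied by y unmatched and y ∼ x*
  inR'M : PMatching m n → Fin m → Fin n → Bool
  inR'M M xs y = not (matchedR M y) ∧ E xs y
                 ∧ allF (λ x' → not (does (x' <? xs) ∧ E x' y))

  addEdge : PMatching m n → Fin m → Fin n → PMatching m n
  addEdge M xs ys x = if does (x ≟ xs) then just ys else M x

  -- one iteration: nothing = "return M", just M' = continue with M'
  step : PMatching m n → Maybe (PMatching m n)
  step M with first (inLM M)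
  ... | nothing = nothing
  ... | just xs with first (inR'M M xs)
  ...   | nothing = nothing
  ...   | just ys = just (addEdge M xs ys)

  run : ℕ → PMatching m n → PMatching m n
  run zero M = M
  run (suc k) M with step M
  ... | nothing = M
  ... | just M' = run k M'

  -- Each continuing iteration matches a new vertex of L, so at most m
  -- iterations continue; fuel m + 1 suffices for the procedure to return.
  greedyPBT : PMatching m n
  greedyPBT = run (suc m) (λ _ → nothing)

MPBT : ∀ {m n} → Graph m n → PMatching m n
MPBT E = Greedy.greedyPBT E

{-# OPTIONS --safe #-}
module Submission where

-- Call y admissible for x when x ∼ y and no x' ≻ x is adjacent to y.  A matching
-- has the PBT-property exactly when every pair in it is admissible, and each y is
-- admissible for at most one x.  Hence, if some PBT matching is L-saturating, every
-- x has a most preferred admissible partner b(x), and x ↦ b(x) is itself an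
-- L-saturating PBT matching which, vertex by vertex, beats any other one; so its
-- order is minimal.  The greedy procedure handles x₁ ≻ x₂ ≻ … in turn, and when it
-- reaches x the vertices b(x') already used for x' ≻ x are not admissible for x,
-- so R'_M consists of the admissible partners of x and the greedy picks b(x).

open import Defs
open import Data.Nat using (ℕ; zero; suc; _+_; _≤_; _<_; z≤n; s≤s; s≤s⁻¹)
import Data.Nat.Properties as ℕ
open import Data.Fin using (Fin; zero; suc; toℕ; fromℕ<; _≟_; _<?_) renaming (_≤_ to _≤ᶠ_; _<_ to _<ᶠ_)
import Data.Fin.Properties as Finₚ
open import Data.Bool using (Bool; true; false; not; _∧_; T)
open import Data.Bool.Properties using (T-∧)
open import Data.Maybe using (Maybe; just; nothing; maybe)
open import Data.Product using (Σ; _×_; _,_; proj₁; proj₂)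
open import Data.Empty using (⊥-elim)
open import Data.Unit using (tt)
open import Function using (_∘_; const)
open import Function.Bundles using (_⇔_; mk⇔; Equivalence)
open import Relation.Nullary using (¬_; Dec; does; yes; no; contradiction)
open import Relation.Binary using (tri<; tri≈; tri>)
open import Relation.Binary.PropositionalEquality using (_≡_; refl; sym; trans; cong; subst)

open Equivalence using (to; from)

T-not : ∀ b → T (not b) ⇔ (¬ T b)
T-not false = mk⇔ (λ _ ()) (const tt)
T-not true  = mk⇔ (λ ()) (λ ¬t → ¬t tt)

T-not-guard : ∀ {P : Set} (P? : Dec P) b → T (not (does P? ∧ b)) ⇔ (P → ¬ T b)
T-not-guard (yes p) b = mk⇔ (λ h _ → to (T-not b) h) (λ h → from (T-not b) (h p))
T-not-guard (no ¬p) b = mk⇔ (λ _ p → contradiction p ¬p) (const tt)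

data IsFirst {k} (p : Fin k → Bool) : Maybe (Fin k) → Set where
  none  : (∀ x → ¬ T (p x)) → IsFirst p nothing
  least : ∀ {z} → T (p z) → (∀ x → x <ᶠ z → ¬ T (p x)) → IsFirst p (just z)

first-isFirst : ∀ {k} (p : Fin k → Bool) → IsFirst p (first p)
first-isFirst {zero}  p = none (λ ())
first-isFirst {suc k} p with p zero in p₀
... | true = least (subst T (sym p₀) tt) (λ _ ())
... | false with first (p ∘ suc) | first-isFirst (p ∘ suc)
...   | nothing | none ¬p = none λ { zero → subst T p₀ ; (suc x) → ¬p x }
...   | just z  | least pz minimal =
        least pz λ { zero _ → subst T p₀ ; (suc x) (s≤s x<z) → minimal x x<z }

isFirst-unique : ∀ {k} {p : Fin k → Bool} {r r'} → IsFirst p r → IsFirst p r' → r ≡ r'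
isFirst-unique (none _)       (none _)         = refl
isFirst-unique (none ¬p)      (least pz _)     = contradiction pz (¬p _)
isFirst-unique (least pz _)   (none ¬p)        = contradiction pz (¬p _)
isFirst-unique (least {z} pz minimal) (least {z'} pz' minimal') with Finₚ.<-cmp z z'
... | tri< z<z' _ _ = contradiction pz (minimal' z z<z')
... | tri≈ _ z≡z' _ = cong just z≡z'
... | tri> _ _ z'<z = contradiction pz' (minimal z' z'<z)

first-just : ∀ {k} (p : Fin k → Bool) {z} → T (p z) → (∀ x → x <ᶠ z → ¬ T (p x)) →
             first p ≡ just z
first-just p pz minimal = isFirst-unique (first-isFirst p) (least pz minimal)

first-nothing : ∀ {k} (p : Fin k → Bool) → (∀ x → ¬ T (p x)) → first p ≡ nothing
first-nothing p ¬p = isFirst-unique (first-isFirst p) (none ¬p)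

first-just⁻ : ∀ {k} (p : Fin k → Bool) {z} → first p ≡ just z →
              T (p z) × (∀ x → x <ᶠ z → ¬ T (p x))
first-just⁻ p eq with first p | first-isFirst p
first-just⁻ p refl | just _ | least pz minimal = pz , minimal

first-least : ∀ {k} (p : Fin k → Bool) {z y} → first p ≡ just z → T (p y) → z ≤ᶠ y
first-least p {y = y} eq py = ℕ.≮⇒≥ (λ y<z → proj₂ (first-just⁻ p eq) y y<z py)

first-total : ∀ {k} (p : Fin k → Bool) {x} → T (p x) → Σ (Fin k) (λ z → first p ≡ just z)
first-total p {x} px with first p | first-isFirst p
... | just z  | _       = z , refl
... | nothing | none ¬p = contradiction px (¬p x)

anyF-intro : ∀ {k} (p : Fin k → Bool) {x} → T (p x) → T (anyF p)
anyF-intro p px with first p | first-isFirst p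
... | just _  | _       = tt
... | nothing | none ¬p = contradiction px (¬p _)

anyF-witness : ∀ {k} (p : Fin k → Bool) → T (anyF p) → Σ (Fin k) (T ∘ p)
anyF-witness p any with first p | first-isFirst p
... | just z | least pz _ = z , pz

allF-intro : ∀ {k} (p : Fin k → Bool) → (∀ x → T (p x)) → T (allF p)
allF-intro p all = from (T-not _) (λ any →
  let (x , ¬px) = anyF-witness (not ∘ p) any in to (T-not (p x)) ¬px (all x))

allF-elim : ∀ {k} (p : Fin k → Bool) → T (allF p) → ∀ x → T (p x)
allF-elim p all x with p x in px
... | true  = tt
... | false = to (T-not _) all (anyF-intro (not ∘ p) (subst (T ∘ not) (sym px) tt))

maxF-mono : ∀ {k} {f g : Fin k → ℕ} → (∀ x → f x ≤ g x) → maxF f ≤ maxF g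
maxF-mono {zero}  f≤g = z≤n
maxF-mono {suc k} f≤g = ℕ.⊔-mono-≤ (f≤g zero) (maxF-mono (f≤g ∘ suc))

order-mono : ∀ {m n} {M M' : PMatching m n} → Saturating M' →
             (∀ x y y' → M x ≡ just y → M' x ≡ just y' → y ≤ᶠ y') → order M ≤ order M'
order-mono {M = M} {M'} saturated y≤y' = maxF-mono pointwise
  where
  pointwise : ∀ x → maybe (suc ∘ toℕ) 0 (M x) ≤ maybe (suc ∘ toℕ) 0 (M' x)
  pointwise x with M x in eq | saturated x
  ... | nothing | _         = z≤n
  ... | just y  | y' , eq' rewrite eq' = s≤s (y≤y' x y y' eq eq')

module Admissibility {m n : ℕ} (E : Graph m n) where
  open Greedy E

  Admissible : Fin m → Fin n → Set
  Admissible x y = T (E x y) × (∀ x' → x' <ᶠ x → ¬ T (E x' y))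

  admissible? : Fin m → Fin n → Bool
  admissible? x y = E x y ∧ allF (λ x' → not (does (x' <? x) ∧ E x' y))

  admissible?-sound : ∀ {x y} → T (admissible? x y) → Admissible x y
  admissible?-sound {x} {y} t =
    proj₁ (to T-∧ t) , λ x' → to (T-not-guard (x' <? x) (E x' y)) (allF-elim _ (proj₂ (to T-∧ t)) x')

  admissible?-complete : ∀ {x y} → Admissible x y → T (admissible? x y)
  admissible?-complete {x} {y} (xy , ¬x'y) =
    from T-∧ (xy , allF-intro _ (λ x' → from (T-not-guard (x' <? x) (E x' y)) (¬x'y x')))

  admissible-unique : ∀ {x x' y} → Admissible x y → Admissible x' y → x ≡ x'
  admissible-unique {x} {x'} (xy , ¬<x) (x'y , ¬<x') with Finₚ.<-cmp x x'
  ... | tri< x<x' _ _ = contradiction xy (¬<x' x x<x')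
  ... | tri≈ _ x≡x' _ = x≡x'
  ... | tri> _ _ x'<x = contradiction x'y (¬<x x' x'<x)

  pbt⇒admissible : ∀ {M} → IsMatching E M → PBT E M → ∀ {x y} → M x ≡ just y → Admissible x y
  pbt⇒admissible (edges , _) pbt {x} {y} eq = edges x y eq , λ x' → pbt x x' y eq

  admissible⇒pbt-matching : ∀ {M} → (∀ {x y} → M x ≡ just y → Admissible x y) →
                            IsMatching E M × PBT E M
  admissible⇒pbt-matching admissible =
    ( (λ x y eq → proj₁ (admissible eq))
    , (λ x x' y eq eq' → admissible-unique (admissible eq) (admissible eq')) )
    , λ x x' y eq → proj₂ (admissible eq) x'

  bestAdmissible : PMatching m n
  bestAdmissible x = first (admissible? x)

  bestAdmissible-admissible : ∀ {x y} → bestAdmissible x ≡ just y → Admissible x y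
  bestAdmissible-admissible {x} eq = admissible?-sound (proj₁ (first-just⁻ (admissible? x) eq))

  bestAdmissible-least : ∀ {x y y'} → bestAdmissible x ≡ just y → Admissible x y' → y ≤ᶠ y'
  bestAdmissible-least {x} eq xy' = first-least (admissible? x) eq (admissible?-complete xy')

  bestAdmissible-saturating : ∀ {M} → IsMatching E M → Saturating M → PBT E M →
                              Saturating bestAdmissible
  bestAdmissible-saturating matching saturated pbt x =
    first-total (admissible? x) (admissible?-complete (pbt⇒admissible matching pbt (proj₂ (saturated x))))

  -- The matching built by the greedy procedure after its first k iterations.
  Prefix : ℕ → PMatching m n → Set
  Prefix k M = ∀ x → (toℕ x < k → M x ≡ bestAdmissible x) × (k ≤ toℕ x → M x ≡ nothing)

  matchedR-sound : ∀ {M y} → T (matchedR M y) → Σ (Fin m) (λ x → M x ≡ just y)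
  matchedR-sound {M} {y} matched with anyF-witness _ matched
  ... | x , hit with M x in eq
  ...   | just y' with y' ≟ y
  ...     | yes refl = x , eq
  ...     | no _     = ⊥-elim hit

  prefix-empty : Prefix 0 (λ _ → nothing)
  prefix-empty x = (λ ()) , (λ _ → refl)

  module _ (saturated : Saturating bestAdmissible) where

    best : Fin m → Fin n
    best x = proj₁ (saturated x)

    best-admissible : ∀ x → Admissible x (best x)
    best-admissible x = bestAdmissible-admissible (proj₂ (saturated x))

    prefix-unmatched : ∀ {k M x y} → Prefix k M → k ≤ toℕ x → Admissible x y →
                       ¬ T (matchedR M y)
    prefix-unmatched {k} prefix k≤x xy matched with matchedR-sound matched
    ... | x' , eq with toℕ x' ℕ.<? k
    ...   | yes x'<k =
            let x'y = bestAdmissible-admissible (trans (sym (proj₁ (prefix x') x'<k)) eq)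
            in ℕ.<⇒≱ (subst (λ v → toℕ v < k) (admissible-unique x'y xy) x'<k) k≤x
    ...   | no x'≮k = contradiction (trans (sym eq) (proj₂ (prefix x') (ℕ.≮⇒≥ x'≮k))) λ ()

    prefix-done : ∀ {k M x} → Prefix k M → toℕ x < k → ¬ T (inLM M x)
    prefix-done {x = x} prefix x<k rewrite trans (proj₁ (prefix x) x<k) (proj₂ (saturated x)) = λ ()

    prefix-pending : ∀ {k M x} → Prefix k M → k ≤ toℕ x → T (inLM M x)
    prefix-pending {x = x} prefix k≤x rewrite proj₂ (prefix x) k≤x =
      anyF-intro _ (from T-∧ ( from (T-not _) (prefix-unmatched prefix k≤x (best-admissible x))
                             , proj₁ (best-admissible x)))

    prefix-next-vertex : ∀ {k M z} → Prefix k M → toℕ z ≡ k → first (inLM M) ≡ just z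
    prefix-next-vertex {M = M} prefix z≡k =
      first-just (inLM M) (prefix-pending prefix (ℕ.≤-reflexive (sym z≡k)))
                 (λ x x<z → prefix-done prefix (subst (toℕ x <_) z≡k x<z))

    prefix-finished : ∀ {M} → Prefix m M → first (inLM M) ≡ nothing
    prefix-finished {M} prefix = first-nothing (inLM M) (λ x → prefix-done prefix (Finₚ.toℕ<n x))

    -- inR'M M z y is definitionally  not (matchedR M y) ∧ admissible? z y.
    prefix-next-partner : ∀ {k M z} → Prefix k M → k ≤ toℕ z → first (inR'M M z) ≡ just (best z)
    prefix-next-partner {M = M} {z} prefix k≤z =
      first-just (inR'M M z)
        (from T-∧ ( from (T-not _) (prefix-unmatched prefix k≤z (best-admissible z))
                  , admissible?-complete (best-admissible z)))
        (λ y y<best t → proj₂ (first-just⁻ (admissible? z) (proj₂ (saturated z))) y y<best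
                                (proj₂ (to (T-∧ {not (matchedR M y)}) t)))

    prefix-step : ∀ {k M z} → Prefix k M → toℕ z ≡ k → step M ≡ just (addEdge M z (best z))
    prefix-step prefix z≡k
      rewrite prefix-next-vertex prefix z≡k
            | prefix-next-partner prefix (ℕ.≤-reflexive (sym z≡k)) = refl

    prefix-stop : ∀ {M} → Prefix m M → step M ≡ nothing
    prefix-stop prefix rewrite prefix-finished prefix = refl

    prefix-addEdge : ∀ {k M z} → Prefix k M → toℕ z ≡ k → Prefix (suc k) (addEdge M z (best z))
    prefix-addEdge {z = z} prefix z≡k x with x ≟ z
    ... | yes refl = (λ _ → sym (proj₂ (saturated z)))
                   , (λ k<z → contradiction k<z (ℕ.<-irrefl (sym z≡k)))
    ... | no x≢z =
          (λ x<1+k → proj₁ (prefix x)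
                       (ℕ.≤∧≢⇒< (s≤s⁻¹ x<1+k) (λ x≡k → x≢z (Finₚ.toℕ-injective (trans x≡k (sym z≡k))))))
          , (λ k<x → proj₂ (prefix x) (ℕ.<⇒≤ k<x))

    run-prefix : ∀ j {k M} → Prefix k M → j + k ≡ m → Prefix m (run (suc j) M)
    run-prefix zero    prefix refl rewrite prefix-stop prefix = prefix
    run-prefix (suc j) {k} {M} prefix j+k≡m =
      subst (Prefix m) (sym continues) (run-prefix j (prefix-addEdge prefix z≡k) j+1+k≡m)
      where
      j+1+k≡m : j + suc k ≡ m
      j+1+k≡m = trans (ℕ.+-suc j k) j+k≡m

      z : Fin m
      z = fromℕ< (ℕ.m+n≤o⇒n≤o j (ℕ.≤-reflexive j+1+k≡m))

      z≡k : toℕ z ≡ k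
      z≡k = Finₚ.toℕ-fromℕ< _

      continues : run (suc (suc j)) M ≡ run (suc j) (addEdge M z (best z))
      continues rewrite prefix-step prefix z≡k = refl

    greedy-bestAdmissible : ∀ x → MPBT E x ≡ bestAdmissible x
    greedy-bestAdmissible x =
      proj₁ (run-prefix m prefix-empty (ℕ.+-identityʳ m) x) (Finₚ.toℕ<n x)

theorem3 : (m n : ℕ) (E : Graph m n) →
    Σ (PMatching m n) (λ M → IsMatching E M × Saturating M × PBT E M) →
    IsMatching E (MPBT E) × Saturating (MPBT E) × PBT E (MPBT E) ×
    ((M : PMatching m n) → IsMatching E M → Saturating M → PBT E M →
      order (MPBT E) ≤ order M)
theorem3 m n E (M₀ , matching₀ , saturated₀ , pbt₀) =
  proj₁ pbt-matching , saturated , proj₂ pbt-matching , minimal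
  where
  open Admissibility E

  best-saturated : Saturating bestAdmissible
  best-saturated = bestAdmissible-saturating matching₀ saturated₀ pbt₀

  greedy-best : ∀ {x y} → MPBT E x ≡ just y → bestAdmissible x ≡ just y
  greedy-best {x} eq = trans (sym (greedy-bestAdmissible best-saturated x)) eq

  pbt-matching : IsMatching E (MPBT E) × PBT E (MPBT E)
  pbt-matching = admissible⇒pbt-matching (bestAdmissible-admissible ∘ greedy-best)

  saturated : Saturating (MPBT E)
  saturated x = proj₁ (best-saturated x)
              , trans (greedy-bestAdmissible best-saturated x) (proj₂ (best-saturated x))

  minimal : (M : PMatching m n) → IsMatching E M → Saturating M → PBT E M →
            order (MPBT E) ≤ order M
  minimal _ matching saturatedM pbt = order-mono saturatedM λ x y y' eq eq' →
    bestAdmissible-least (greedy-best eq) (pbt⇒admissible matching pbt eq')
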